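{- Fix any logic $\mathcal{L}$. Let $c$ be a closed computation with $\vdash c : \mathtt{bool}\,!\,\emptyset/\emptyset$ and $v$ a closed value with $\vdash v:\mathtt{bool}$. If $[\![ \vdash c : \mathtt{bool}\,!\,\emptyset/\emptyset ]\!] \sim_{\mathtt{bool}\,!\,\emptyset/\emptyset} \mathrm{in}_{\mathrm{ret}}([\![ \vdash v : \mathtt{bool} ]\!])$, then $c \leadsto^* \mathtt{return}\ v$.
   Context: Calculus. Values $v ::= x \mid () \mid \mathtt{true} \mid \mathtt{false} \mid \mathtt{fun}\,x\mapsto c \mid \mathtt{handler}\,\{\mathtt{return}\,x \mapsto c_r;\ h\}$; computations $c ::= \mathtt{if}\ v\ \mathtt{then}\ c_1\ \mathtt{else}\ c_2 \mid v_1\,v_2 \mid \mathtt{return}\ v \mid \mathit{op}(v; y.c) \mid \mathtt{do}\ x \leftarrow c_1\ \mathtt{in}\ c_2 \mid \mathtt{with}\ v\ \mathtt{handle}\ c$; operation clauses $h$ are finite sets of clauses $\mathit{op}(x;k)\mapsto c_{\mathit{op}}$, at most one per symbol. Value types $A,B ::= \mathtt{unit}\mid \mathtt{bool} \mid A \to \underline{C} \mid \underline{C}\Rightarrow \underline{D}$; computation types $\underline{C} ::= A\,!\,\Sigma/\mathcal{E}$, with $\Sigma$ a finite set of declarations $\mathit{op}: A_{\mathit{op}} \to B_{\mathit{op}}$ and $\mathcal{E}$ a finite set of equations between templates $T ::= z\,v \mid \mathtt{if}\ v\ \mathtt{then}\ T_1\ \mathtt{else}\ T_2 \mid \mathit{op}(v;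 y.T)$. Typing (mutually defined). Values: variables from context; $()$ : unit; $\mathtt{true},\mathtt{false}$ : bool; $\mathtt{fun}\,x\mapsto c:A\to\underline C$ if $\Gamma,x:A\vdash c:\underline C$; $\mathtt{handler}\{\mathtt{return}\,x\mapsto c_r;h\}: A\,!\,\Sigma/\mathcal E\Rightarrow\underline D$ if $\Gamma,x:A\vdash c_r:\underline D$ and $\Gamma\vdash h\models\mathcal E:\Sigma\rightrightarrows\underline D$. Computations: $\mathtt{if}$ : $\underline C$ if guard bool and branches $\underline C$; $v_1\,v_2:\underline C$ if $v_1:A\to\underline C$, $v_2:A$; $\mathtt{return}\,v:A\,!\,\Sigma/\mathcal E$ if $v:A$; $\mathit{op}(v;y.c):A\,!\,\Sigma/\mathcal E$ if $(\mathit{op}:A_{op}\to B_{op})\in\Sigma$, $v:A_{op}$, $\Gamma,y:B_{op}\vdash c:A\,!\,\Sigma/\mathcal E$; $\mathtt{do}\,x\leftarrow c_1\,\mathtt{in}\,c_2:B\,!\,\Sigma/\mathcal E$ if $c_1:A\,!\,\Sigma/\mathcal E$, $\Gamma,x:A\vdash c_2:B\,!\,\Sigma/\mathcal E$; $\mathtt{with}\,v\,\mathtt{handle}\,c:\underline D$ if $v:\underline C\Rightarrow\underline D$, $c:\underline C$. Clauses: $\Gamma\vdash h:\Sigma\rightrightarrows\underline D$ iff exactly one clause per operation of $\Sigma$ and no others, with $\Gamma,x:A_{op},k:B_{op}\to\underline D\vdash c_{op}:\underline D$. A logic is any choice of the judgment $\Gamma\vdash h\models\mathcal E:\Sigma\rightrightarrows\underline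 D$, holding only when $\Gamma\vdash h:\Sigma\rightrightarrows\underline D$ (and templates of $\mathcal E$ are well-typed w.r.t. $\Sigma$). Small steps: $\mathtt{if}\,\mathtt{true}\,\mathtt{then}\,c_1\,\mathtt{else}\,c_2\leadsto c_1$, with $\mathtt{false}$ $\leadsto c_2$; $(\mathtt{fun}\,x\mapsto c)\,v\leadsto c[v/x]$; congruence in the first component of $\mathtt{do}$; $\mathtt{do}\,x\leftarrow\mathtt{return}\,v\,\mathtt{in}\,c\leadsto c[v/x]$; $\mathtt{do}\,x\leftarrow\mathit{op}(v;y.c_1)\,\mathtt{in}\,c_2\leadsto\mathit{op}(v;y.\mathtt{do}\,x\leftarrow c_1\,\mathtt{in}\,c_2)$; congruence in the handled computation; for $H=\mathtt{handler}\{\mathtt{return}\,x\mapsto c_r;h\}$: $\mathtt{with}\,H\,\mathtt{handle}\,\mathtt{return}\,v\leadsto c_r[v/x]$ and $\mathtt{with}\,H\,\mathtt{handle}\,\mathit{op}(v;y.c)\leadsto c_{op}[v/x,(\mathtt{fun}\,y\mapsto\mathtt{with}\,H\,\mathtt{handle}\,c)/k]$ if $(\mathit{op}(x;k)\mapsto c_{op})\in h$; $\leadsto^*$ is the reflexive-transitive closure. Denotational semantics (ignores theories). $[\![\mathtt{unit}]\!]=\{\star\}$, $[\![\mathtt{bool}]\!]=\{\mathrm{ff},\mathrm{tt}\}$, function and handler types denote function sets, $[\![A\,!\,\Sigma/\mathcal E]\!]=[\![\Sigma]\!][\![A]\!]$, the inductive set generated by $\mathrm{in}_{\mathrm{ret}}(a)$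 and $\mathrm{in}_{op}(a;\kappa)$ ($\mathit{op}\in\Sigma$, $a\in[\![A_{op}]\!]$, $\kappa:[\![B_{op}]\!]\to[\![\Sigma]\!][\![A]\!]$). Lift: for an interpretation $H$ ($H_{op}:[\![A_{op}]\!]\times([\![B_{op}]\!]\to Y)\to Y$) and $f:X\to Y$, $f^\dagger_H(\mathrm{in}_{\mathrm{ret}}(x))=f(x)$, $f^\dagger_H(\mathrm{in}_{op}(a;\kappa))=H_{op}(a,f^\dagger_H\circ\kappa)$; $F^X_\Sigma$ is the free interpretation $\mathrm{in}_{op}$. Terms: variables are projections; $\mathtt{true}\mapsto\mathrm{tt}$, $\mathtt{false}\mapsto\mathrm{ff}$, $()\mapsto\star$; $[\![\mathtt{fun}\,x\mapsto c]\!]\eta=\lambda a.[\![c]\!](\eta,a)$; $[\![\mathtt{handler}\{\mathtt{return}\,x\mapsto c_r;h\}]\!]\eta=(\lambda a.[\![c_r]\!](\eta,a))^\dagger_{H}$ with $H_{op}(a,\kappa)=[\![c_{op}]\!](\eta,a,\kappa)$; $\mathtt{if}$ by cases; application is function application; $[\![\mathtt{return}\,v]\!]\eta=\mathrm{in}_{\mathrm{ret}}([\![v]\!]\eta)$; $[\![\mathit{op}(v;y.c)]\!]\eta=\mathrm{in}_{op}([\![v]\!]\eta;\lambda b.[\![c]\!](\eta,b))$; $[\![\mathtt{do}\,x\leftarrow c_1\,\mathtt{in}\,c_2]\!]\eta=(\lambda a.[\![c_2]\!](\eta,a))^\dagger_{F}([\![c_1]\!]\eta)$; $[\![\mathtt{with}\,v\,\mathtt{handle}\,c]\!]\eta=[\![v]\!]\eta([\![c]\!]\eta)$.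 Closed terms are identified with elements. Relation: for $\underline C=A\,!\,\Sigma/\mathcal E$, $\sim_{\underline C}$ is the smallest symmetric, transitive relation on $[\![\underline C]\!]$ with $\mathrm{in}_{\mathrm{ret}}(a)\sim\mathrm{in}_{\mathrm{ret}}(a')$ whenever $a\sim_A a'$, closed under operation constructors applied to related arguments and related continuations, and containing all instances of equations of $\mathcal E$ at related arguments; $\sim_{\mathtt{bool}}$ is the identity. In particular $\sim_{\mathtt{bool}\,!\,\emptyset/\emptyset}$ relates $\mathrm{in}_{\mathrm{ret}}(b)$ and $\mathrm{in}_{\mathrm{ret}}(b')$ exactly when $b=b'$. -}

module Defs where

open import Data.Nat using (ℕ; zero; suc)
open import Data.Bool using (Bool; true; false; if_then_else_)
open import Data.Unit using (⊤; tt)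
open import Data.Empty using (⊥)
open import Data.Sum using (_⊎_; inj₁; inj₂)
open import Data.Product using (_×_; _,_)
open import Data.List using (List; []; _∷_)
open import Data.List.Membership.Propositional using (_∈_)
open import Data.List.Relation.Unary.Any using (here; there)
open import Data.List.Relation.Unary.Unique.Propositional using (Unique)
open import Relation.Binary.PropositionalEquality using (_≡_; refl)
import Data.List.Relation.Unary.AllPairs as AP
open import Relation.Binary.Construct.Closure.ReflexiveTransitive using (Star)

Op : Set
Op = ℕ

-- Raw syntax (de Bruijn indices; variable 0 is the most recently bound)

data Val : Set
data Comp : Set
data Clauses : Set

data Val where
  ‵var     : ℕ → Val
  ‵unit    : Val
  ‵true    : Val
  ‵false   : Val
  ‵fun     : Comp → Val                 -- fun x ↦ c   (x bound in c)
  ‵handler : Comp → Clauses → Val       -- handler {return x ↦ c_r ; h}  (x bound in c_r)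

data Comp where
  ‵if          : Val → Comp → Comp → Comp
  ‵app         : Val → Val → Comp
  ‵return      : Val → Comp
  ‵op          : Op → Val → Comp → Comp  -- op(v ; y.c)   (y bound in c)
  ‵do          : Comp → Comp → Comp      -- do x ← c₁ in c₂  (x bound in c₂)
  ‵with_handle_ : Val → Comp → Comp

-- operation clauses  op(x ; k) ↦ c_op ; in c_op, k is variable 0 and x is variable 1
data Clauses where
  []      : Clauses
  _↦_∷_   : Op → Comp → Clauses → Clauses

data _↦_∈ᶜ_ : Op → Comp → Clauses → Set where
  here  : ∀ {o c h} → o ↦ c ∈ᶜ (o ↦ c ∷ h)
  there : ∀ {o c o' c' h} → o ↦ c ∈ᶜ h → o ↦ c ∈ᶜ (o' ↦ c' ∷ h)

clauseNames : Clauses → List Op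
clauseNames []            = []
clauseNames (o ↦ _ ∷ h)   = o ∷ clauseNames h

data Template : Set where
  ‵tapp : ℕ → Val → Template             -- z v  (z a template variable, by index)
  ‵tif  : Val → Template → Template → Template
  ‵top  : Op → Val → Template → Template  -- y bound in T

data VTy  : Set
data CTy  : Set
data Decl : Set
data Eqn  : Set
declNames : List Decl → List Op

data VTy where
  unit bool : VTy
  _⟶_ : VTy → CTy → VTy
  _⇒_ : CTy → CTy → VTy

data Decl where
  decl : Op → VTy → VTy → Decl

declNames []                 = []
declNames (decl o _ _ ∷ ds)  = o ∷ declNames ds

-- A ! Σ / E ; a signature is a finite set of declarations, at most one per symbol
data CTy where
  comp : (A : VTy) (Σ : List Decl) → Unique (declNames Σ) → List Eqn → CTy

-- an equation  Δ ; Z ⊢ T₁ ~ T₂  (Δ : value context, Z : argument types of template variables)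
data Eqn where
  eqn : (Δ Z : List VTy) → Template → Template → Eqn

Ctx : Set
Ctx = List VTy

data _∋_⦂_ : Ctx → ℕ → VTy → Set where
  here  : ∀ {Γ A} → (A ∷ Γ) ∋ 0 ⦂ A
  there : ∀ {Γ A B n} → Γ ∋ n ⦂ A → (B ∷ Γ) ∋ suc n ⦂ A

-- a logic: an arbitrary judgment  Γ ⊢ h ⊨ E : Σ ⇉ D
Logic : Set₁
Logic = Ctx → Clauses → List Eqn → List Decl → CTy → Set

data _∣_⊢v_⦂_ (L : Logic) : Ctx → Val → VTy → Set
data _∣_⊢c_⦂_ (L : Logic) : Ctx → Comp → CTy → Set
data ClausesTy (L : Logic) (Γ : Ctx) (h : Clauses) (D : CTy) : List Decl → Set
data TemplTy (L : Logic) (Σ : List Decl) : Ctx → List VTy → Template → Set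
data EqnsTy (L : Logic) (Σ : List Decl) : List Eqn → Set

data _∣_⊢v_⦂_ L where
  varT     : ∀ {Γ n A} → Γ ∋ n ⦂ A → L ∣ Γ ⊢v ‵var n ⦂ A
  unitT    : ∀ {Γ} → L ∣ Γ ⊢v ‵unit ⦂ unit
  trueT    : ∀ {Γ} → L ∣ Γ ⊢v ‵true ⦂ bool
  falseT   : ∀ {Γ} → L ∣ Γ ⊢v ‵false ⦂ bool
  funT     : ∀ {Γ A C c} → L ∣ (A ∷ Γ) ⊢c c ⦂ C → L ∣ Γ ⊢v ‵fun c ⦂ (A ⟶ C)
  handlerT : ∀ {Γ A Σ u E D cr h} →
             L ∣ (A ∷ Γ) ⊢c cr ⦂ D →
             -- Γ ⊢ h ⊨ E : Σ ⇉ D  (the logic), which holds only when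
             -- Γ ⊢ h : Σ ⇉ D and the templates of E are well-typed w.r.t. Σ:
             ClausesTy L Γ h D Σ →
             (∀ {o c} → o ↦ c ∈ᶜ h → o ∈ declNames Σ) →
             Unique (clauseNames h) →
             EqnsTy L Σ E →
             L Γ h E Σ D →
             L ∣ Γ ⊢v ‵handler cr h ⦂ (comp A Σ u E ⇒ D)

data _∣_⊢c_⦂_ L where
  ifT     : ∀ {Γ v c₁ c₂ C} → L ∣ Γ ⊢v v ⦂ bool → L ∣ Γ ⊢c c₁ ⦂ C → L ∣ Γ ⊢c c₂ ⦂ C →
            L ∣ Γ ⊢c ‵if v c₁ c₂ ⦂ C
  appT    : ∀ {Γ v₁ v₂ A C} → L ∣ Γ ⊢v v₁ ⦂ (A ⟶ C) → L ∣ Γ ⊢v v₂ ⦂ A →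
            L ∣ Γ ⊢c ‵app v₁ v₂ ⦂ C
  returnT : ∀ {Γ v A Σ u E} → L ∣ Γ ⊢v v ⦂ A → L ∣ Γ ⊢c ‵return v ⦂ comp A Σ u E
  opT     : ∀ {Γ o v c A Σ u E Aop Bop} → decl o Aop Bop ∈ Σ →
            L ∣ Γ ⊢v v ⦂ Aop → L ∣ (Bop ∷ Γ) ⊢c c ⦂ comp A Σ u E →
            L ∣ Γ ⊢c ‵op o v c ⦂ comp A Σ u E
  doT     : ∀ {Γ c₁ c₂ A B Σ u E} → L ∣ Γ ⊢c c₁ ⦂ comp A Σ u E →
            L ∣ (A ∷ Γ) ⊢c c₂ ⦂ comp B Σ u E → L ∣ Γ ⊢c ‵do c₁ c₂ ⦂ comp B Σ u E
  withT   : ∀ {Γ v c C D} → L ∣ Γ ⊢v v ⦂ (C ⇒ D) → L ∣ Γ ⊢c c ⦂ C →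
            L ∣ Γ ⊢c ‵with v handle c ⦂ D

data ClausesTy L Γ h D where
  []  : ClausesTy L Γ h D []
  _∷_ : ∀ {o Aop Bop Σ cop} →
        (o ↦ cop ∈ᶜ h) × (L ∣ ((Bop ⟶ D) ∷ Aop ∷ Γ) ⊢c cop ⦂ D) →
        ClausesTy L Γ h D Σ → ClausesTy L Γ h D (decl o Aop Bop ∷ Σ)

data TemplTy L Σ where
  tappT : ∀ {Δ Z z v A} → Z ∋ z ⦂ A → L ∣ Δ ⊢v v ⦂ A → TemplTy L Σ Δ Z (‵tapp z v)
  tifT  : ∀ {Δ Z v T₁ T₂} → L ∣ Δ ⊢v v ⦂ bool → TemplTy L Σ Δ Z T₁ → TemplTy L Σ Δ Z T₂ →
          TemplTy L Σ Δ Z (‵tif v T₁ T₂)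
  topT  : ∀ {Δ Z o v T Aop Bop} → decl o Aop Bop ∈ Σ → L ∣ Δ ⊢v v ⦂ Aop →
          TemplTy L Σ (Bop ∷ Δ) Z T → TemplTy L Σ Δ Z (‵top o v T)

data EqnsTy L Σ where
  []  : EqnsTy L Σ []
  _∷_ : ∀ {Δ Z T₁ T₂ E} → TemplTy L Σ Δ Z T₁ × TemplTy L Σ Δ Z T₂ → EqnsTy L Σ E →
        EqnsTy L Σ (eqn Δ Z T₁ T₂ ∷ E)

ext : (ℕ → ℕ) → ℕ → ℕ
ext ρ zero    = zero
ext ρ (suc n) = suc (ρ n)

renV : (ℕ → ℕ) → Val → Val
renC : (ℕ → ℕ) → Comp → Comp
renH : (ℕ → ℕ) → Clauses → Clauses
renV ρ (‵var n)        = ‵var (ρ n)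
renV ρ ‵unit           = ‵unit
renV ρ ‵true           = ‵true
renV ρ ‵false          = ‵false
renV ρ (‵fun c)        = ‵fun (renC (ext ρ) c)
renV ρ (‵handler cr h) = ‵handler (renC (ext ρ) cr) (renH ρ h)
renC ρ (‵if v c₁ c₂)       = ‵if (renV ρ v) (renC ρ c₁) (renC ρ c₂)
renC ρ (‵app v₁ v₂)        = ‵app (renV ρ v₁) (renV ρ v₂)
renC ρ (‵return v)         = ‵return (renV ρ v)
renC ρ (‵op o v c)         = ‵op o (renV ρ v) (renC (ext ρ) c)
renC ρ (‵do c₁ c₂)         = ‵do (renC ρ c₁) (renC (ext ρ) c₂)
renC ρ (‵with v handle c)  = ‵with renV ρ v handle renC ρ c
renH ρ []            = []
renH ρ (o ↦ c ∷ h)   = o ↦ renC (ext (ext ρ)) c ∷ renH ρ h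

exts : (ℕ → Val) → ℕ → Val
exts σ zero    = ‵var zero
exts σ (suc n) = renV suc (σ n)

subV : (ℕ → Val) → Val → Val
subC : (ℕ → Val) → Comp → Comp
subH : (ℕ → Val) → Clauses → Clauses
subV σ (‵var n)        = σ n
subV σ ‵unit           = ‵unit
subV σ ‵true           = ‵true
subV σ ‵false          = ‵false
subV σ (‵fun c)        = ‵fun (subC (exts σ) c)
subV σ (‵handler cr h) = ‵handler (subC (exts σ) cr) (subH σ h)
subC σ (‵if v c₁ c₂)       = ‵if (subV σ v) (subC σ c₁) (subC σ c₂)
subC σ (‵app v₁ v₂)        = ‵app (subV σ v₁) (subV σ v₂)
subC σ (‵return v)         = ‵return (subV σ v)
subC σ (‵op o v c)         = ‵op o (subV σ v) (subC (exts σ) c)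
subC σ (‵do c₁ c₂)         = ‵do (subC σ c₁) (subC (exts σ) c₂)
subC σ (‵with v handle c)  = ‵with subV σ v handle subC σ c
subH σ []            = []
subH σ (o ↦ c ∷ h)   = o ↦ subC (exts (exts σ)) c ∷ subH σ h

_[_] : Comp → Val → Comp
c [ v ] = subC σ c
  where
  σ : ℕ → Val
  σ zero    = v
  σ (suc n) = ‵var n

_[_/x,_/k] : Comp → Val → Val → Comp
c [ v /x, w /k] = subC σ c
  where
  σ : ℕ → Val
  σ zero          = w
  σ (suc zero)    = v
  σ (suc (suc n)) = ‵var n

infix 4 _↝_ _↝*_
data _↝_ : Comp → Comp → Set where
  ifTrue   : ∀ {c₁ c₂} → ‵if ‵true c₁ c₂ ↝ c₁
  ifFalse  : ∀ {c₁ c₂} → ‵if ‵false c₁ c₂ ↝ c₂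
  β        : ∀ {c v} → ‵app (‵fun c) v ↝ c [ v ]
  doCong   : ∀ {c₁ c₁' c₂} → c₁ ↝ c₁' → ‵do c₁ c₂ ↝ ‵do c₁' c₂
  doReturn : ∀ {v c} → ‵do (‵return v) c ↝ c [ v ]
  doOp     : ∀ {o v c₁ c₂} →
             ‵do (‵op o v c₁) c₂ ↝ ‵op o v (‵do c₁ (renC (ext suc) c₂))
  withCong : ∀ {v c c'} → c ↝ c' → ‵with v handle c ↝ ‵with v handle c'
  withReturn : ∀ {cr h v} → ‵with ‵handler cr h handle ‵return v ↝ cr [ v ]
  withOp   : ∀ {cr h o v c cop} → o ↦ cop ∈ᶜ h →
             ‵with ‵handler cr h handle ‵op o v c
               ↝ cop [ v /x, ‵fun (‵with renV suc (‵handler cr h) handle c) /k]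

_↝*_ : Comp → Comp → Set
_↝*_ = Star _↝_

-- Denotational semantics (ignores theories)

-- the inductive set generated by in_ret and in_op (shape = operation with its parameter)
data Free (S : Set) (P : S → Set) (X : Set) : Set where
  inRet : X → Free S P X
  inOp  : (s : S) → (P s → Free S P X) → Free S P X

lift : ∀ {S : Set} {P : S → Set} {X Y : Set} → (X → Y) → ((s : S) → (P s → Y) → Y) → Free S P X → Y
lift f H (inRet x)   = f x
lift f H (inOp s κ)  = H s (λ p → lift f H (κ p))

⟦_⟧V : VTy → Set
⟦_⟧C : CTy → Set
Sh   : List Decl → Set
Ps   : (Σ : List Decl) → Sh Σ → Set

⟦ unit ⟧V   = ⊤
⟦ bool ⟧V   = Bool
⟦ A ⟶ C ⟧V  = ⟦ A ⟧V → ⟦ C ⟧C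
⟦ C ⇒ D ⟧V  = ⟦ C ⟧C → ⟦ D ⟧C
⟦ comp A Σ _ _ ⟧C = Free (Sh Σ) (Ps Σ) ⟦ A ⟧V
Sh []                  = ⊥
Sh (decl _ A _ ∷ Σ)    = ⟦ A ⟧V ⊎ Sh Σ
Ps (decl _ _ B ∷ Σ) (inj₁ _) = ⟦ B ⟧V
Ps (decl _ _ _ ∷ Σ) (inj₂ s) = Ps Σ s

Env : Ctx → Set
Env []      = ⊤
Env (A ∷ Γ) = ⟦ A ⟧V × Env Γ

lookupEnv : ∀ {Γ n A} → Γ ∋ n ⦂ A → Env Γ → ⟦ A ⟧V
lookupEnv here      (a , _) = a
lookupEnv (there x) (_ , η) = lookupEnv x η

shape : ∀ {o A B Σ} → decl o A B ∈ Σ → ⟦ A ⟧V → Sh Σ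
shape (here refl) a = inj₁ a
shape {Σ = decl _ _ _ ∷ _} (there m) a = inj₂ (shape m a)

pos : ∀ {o A B Σ} (m : decl o A B ∈ Σ) (a : ⟦ A ⟧V) → Ps Σ (shape m a) → ⟦ B ⟧V
pos (here refl) a p = p
pos {Σ = decl _ _ _ ∷ _} (there m) a p = pos m a p

module _ {L : Logic} where
  ⟦_⟧v : ∀ {Γ v A} → L ∣ Γ ⊢v v ⦂ A → Env Γ → ⟦ A ⟧V
  ⟦_⟧c : ∀ {Γ c C} → L ∣ Γ ⊢c c ⦂ C → Env Γ → ⟦ C ⟧C
  interp : ∀ {Γ h D Σ} → ClausesTy L Γ h D Σ → Env Γ → (s : Sh Σ) → (Ps Σ s → ⟦ D ⟧C) → ⟦ D ⟧C

  ⟦ varT x ⟧v η   = lookupEnv x η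
  ⟦ unitT ⟧v η    = tt
  ⟦ trueT ⟧v η    = true
  ⟦ falseT ⟧v η   = false
  ⟦ funT d ⟧v η   = λ a → ⟦ d ⟧c (a , η)
  ⟦ handlerT dr cls _ _ _ _ ⟧v η = lift (λ a → ⟦ dr ⟧c (a , η)) (interp cls η)

  ⟦ ifT dv d₁ d₂ ⟧c η   = if ⟦ dv ⟧v η then ⟦ d₁ ⟧c η else ⟦ d₂ ⟧c η
  ⟦ appT d₁ d₂ ⟧c η     = ⟦ d₁ ⟧v η (⟦ d₂ ⟧v η)
  ⟦ returnT dv ⟧c η     = inRet (⟦ dv ⟧v η)
  ⟦ opT m dv dc ⟧c η    = inOp (shape m (⟦ dv ⟧v η)) (λ p → ⟦ dc ⟧c (pos m (⟦ dv ⟧v η) p , η))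
  ⟦ doT d₁ d₂ ⟧c η      = lift (λ a → ⟦ d₂ ⟧c (a , η)) inOp (⟦ d₁ ⟧c η)
  ⟦ withT dv dc ⟧c η    = ⟦ dv ⟧v η (⟦ dc ⟧c η)

  interp ((_ , d) ∷ cls) η (inj₁ a) κ = ⟦ d ⟧c (κ , a , η)
  interp (_ ∷ cls)       η (inj₂ s) κ = interp cls η s κ

bool!∅/∅ : CTy
bool!∅/∅ = comp bool [] AP.[] []

-- smallest symmetric, transitive relation containing in_ret b ∼ in_ret b' for b ∼_bool b'
-- (∼_bool is the identity), closed under operation constructors (vacuous: Σ = ∅);
-- there are no equation instances since E = ∅.
infix 4 _∼_
data _∼_ : ⟦ bool!∅/∅ ⟧C → ⟦ bool!∅/∅ ⟧C → Set where
  ∼ret   : ∀ {b b'} → b ≡ b' → inRet b ∼ inRet b'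
  ∼sym   : ∀ {x y} → x ∼ y → y ∼ x
  ∼trans : ∀ {x y z} → x ∼ y → y ∼ z → x ∼ z
  ∼op    : ∀ (s : Sh []) {κ κ'} → (∀ p → κ p ∼ κ' p) → inOp s κ ∼ inOp s κ'

-- Adequacy by a logical relation between denotations and closed syntax. The tree
-- inRet a is related to computations reducing to return v with v related to a; the
-- tree inOp s κ to computations reducing to an operation call of shape s whose
-- continuation is related to κ at every related argument. By induction on typing,
-- every well-typed term is related to its denotation under any related closing
-- substitution. At bool!∅/∅ there are no operations, so ∼ is equality and c is
-- related to inRet ⟦v⟧: it reduces to the boolean literal ⟦v⟧, and the relation at
-- bool says that v is that very literal.
module Submission where

open import Defs
open import Data.Bool using (Bool; true; false; if_then_else_)
open import Data.List using (List; []; _∷_)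
open import Data.List.Membership.Propositional using (_∈_)
open import Data.List.Relation.Unary.Any using (here; there)
open import Data.Nat using (ℕ; zero; suc)
open import Data.Product using (∃; _×_; _,_)
open import Data.Sum using (inj₁; inj₂)
open import Data.Unit using (⊤; tt)
open import Function using (_∘_; id)
open import Relation.Binary.PropositionalEquality
  using (_≡_; _≗_; refl; sym; trans; cong; cong₂; subst)
open import Relation.Binary.Construct.Closure.ReflexiveTransitive
  using (ε; _◅_; _◅◅_; gmap)

private variable
  ρ ρ' ρ'' : ℕ → ℕ
  σ σ' τ υ : ℕ → Val

cong₃ : ∀ {A B C D : Set} (f : A → B → C → D) {a a' b b' c c'} →
        a ≡ a' → b ≡ b' → c ≡ c' → f a b c ≡ f a' b' c'
cong₃ f refl refl refl = refl

ext-∘ : ρ ∘ ρ' ≗ ρ'' → ext ρ ∘ ext ρ' ≗ ext ρ''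
ext-∘ e zero    = refl
ext-∘ e (suc n) = cong suc (e n)

renV-renV : ρ ∘ ρ' ≗ ρ'' → renV ρ ∘ renV ρ' ≗ renV ρ''
renC-renC : ρ ∘ ρ' ≗ ρ'' → renC ρ ∘ renC ρ' ≗ renC ρ''
renH-renH : ρ ∘ ρ' ≗ ρ'' → renH ρ ∘ renH ρ' ≗ renH ρ''
renV-renV e (‵var n)        = cong ‵var (e n)
renV-renV e ‵unit           = refl
renV-renV e ‵true           = refl
renV-renV e ‵false          = refl
renV-renV e (‵fun c)        = cong ‵fun (renC-renC (ext-∘ e) c)
renV-renV e (‵handler cr h) = cong₂ ‵handler (renC-renC (ext-∘ e) cr) (renH-renH e h)
renC-renC e (‵if v c₁ c₂)      = cong₃ ‵if (renV-renV e v) (renC-renC e c₁) (renC-renC e c₂)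
renC-renC e (‵app v₁ v₂)       = cong₂ ‵app (renV-renV e v₁) (renV-renV e v₂)
renC-renC e (‵return v)        = cong ‵return (renV-renV e v)
renC-renC e (‵op o v c)        = cong₂ (‵op o) (renV-renV e v) (renC-renC (ext-∘ e) c)
renC-renC e (‵do c₁ c₂)        = cong₂ ‵do (renC-renC e c₁) (renC-renC (ext-∘ e) c₂)
renC-renC e (‵with v handle c) = cong₂ ‵with_handle_ (renV-renV e v) (renC-renC e c)
renH-renH e []          = refl
renH-renH e (o ↦ c ∷ h) = cong₂ (o ↦_∷_) (renC-renC (ext-∘ (ext-∘ e)) c) (renH-renH e h)

exts-ext : σ ∘ ρ ≗ τ → exts σ ∘ ext ρ ≗ exts τ
exts-ext e zero    = refl
exts-ext e (suc n) = cong (renV suc) (e n)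

subV-renV : σ ∘ ρ ≗ τ → subV σ ∘ renV ρ ≗ subV τ
subC-renC : σ ∘ ρ ≗ τ → subC σ ∘ renC ρ ≗ subC τ
subH-renH : σ ∘ ρ ≗ τ → subH σ ∘ renH ρ ≗ subH τ
subV-renV e (‵var n)        = e n
subV-renV e ‵unit           = refl
subV-renV e ‵true           = refl
subV-renV e ‵false          = refl
subV-renV e (‵fun c)        = cong ‵fun (subC-renC (exts-ext e) c)
subV-renV e (‵handler cr h) = cong₂ ‵handler (subC-renC (exts-ext e) cr) (subH-renH e h)
subC-renC e (‵if v c₁ c₂)      = cong₃ ‵if (subV-renV e v) (subC-renC e c₁) (subC-renC e c₂)
subC-renC e (‵app v₁ v₂)       = cong₂ ‵app (subV-renV e v₁) (subV-renV e v₂)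
subC-renC e (‵return v)        = cong ‵return (subV-renV e v)
subC-renC e (‵op o v c)        = cong₂ (‵op o) (subV-renV e v) (subC-renC (exts-ext e) c)
subC-renC e (‵do c₁ c₂)        = cong₂ ‵do (subC-renC e c₁) (subC-renC (exts-ext e) c₂)
subC-renC e (‵with v handle c) = cong₂ ‵with_handle_ (subV-renV e v) (subC-renC e c)
subH-renH e []          = refl
subH-renH e (o ↦ c ∷ h) = cong₂ (o ↦_∷_) (subC-renC (exts-ext (exts-ext e)) c) (subH-renH e h)

ext-exts : renV ρ ∘ σ ≗ τ → renV (ext ρ) ∘ exts σ ≗ exts τ
ext-exts e zero = refl
ext-exts {σ = σ} e (suc n) =
  trans (renV-renV (λ _ → refl) (σ n)) (trans (sym (renV-renV (λ _ → refl) (σ n))) (cong (renV suc) (e n)))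

renV-subV : renV ρ ∘ σ ≗ τ → renV ρ ∘ subV σ ≗ subV τ
renC-subC : renV ρ ∘ σ ≗ τ → renC ρ ∘ subC σ ≗ subC τ
renH-subH : renV ρ ∘ σ ≗ τ → renH ρ ∘ subH σ ≗ subH τ
renV-subV e (‵var n)        = e n
renV-subV e ‵unit           = refl
renV-subV e ‵true           = refl
renV-subV e ‵false          = refl
renV-subV e (‵fun c)        = cong ‵fun (renC-subC (ext-exts e) c)
renV-subV e (‵handler cr h) = cong₂ ‵handler (renC-subC (ext-exts e) cr) (renH-subH e h)
renC-subC e (‵if v c₁ c₂)      = cong₃ ‵if (renV-subV e v) (renC-subC e c₁) (renC-subC e c₂)
renC-subC e (‵app v₁ v₂)       = cong₂ ‵app (renV-subV e v₁) (renV-subV e v₂)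
renC-subC e (‵return v)        = cong ‵return (renV-subV e v)
renC-subC e (‵op o v c)        = cong₂ (‵op o) (renV-subV e v) (renC-subC (ext-exts e) c)
renC-subC e (‵do c₁ c₂)        = cong₂ ‵do (renC-subC e c₁) (renC-subC (ext-exts e) c₂)
renC-subC e (‵with v handle c) = cong₂ ‵with_handle_ (renV-subV e v) (renC-subC e c)
renH-subH e []          = refl
renH-subH e (o ↦ c ∷ h) = cong₂ (o ↦_∷_) (renC-subC (ext-exts (ext-exts e)) c) (renH-subH e h)

exts-exts : subV τ ∘ σ ≗ υ → subV (exts τ) ∘ exts σ ≗ exts υ
exts-exts e zero = refl
exts-exts {σ = σ} e (suc n) =
  trans (subV-renV (λ _ → refl) (σ n)) (trans (sym (renV-subV (λ _ → refl) (σ n))) (cong (renV suc) (e n)))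

subV-subV : subV τ ∘ σ ≗ υ → subV τ ∘ subV σ ≗ subV υ
subC-subC : subV τ ∘ σ ≗ υ → subC τ ∘ subC σ ≗ subC υ
subH-subH : subV τ ∘ σ ≗ υ → subH τ ∘ subH σ ≗ subH υ
subV-subV e (‵var n)        = e n
subV-subV e ‵unit           = refl
subV-subV e ‵true           = refl
subV-subV e ‵false          = refl
subV-subV e (‵fun c)        = cong ‵fun (subC-subC (exts-exts e) c)
subV-subV e (‵handler cr h) = cong₂ ‵handler (subC-subC (exts-exts e) cr) (subH-subH e h)
subC-subC e (‵if v c₁ c₂)      = cong₃ ‵if (subV-subV e v) (subC-subC e c₁) (subC-subC e c₂)
subC-subC e (‵app v₁ v₂)       = cong₂ ‵app (subV-subV e v₁) (subV-subV e v₂)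
subC-subC e (‵return v)        = cong ‵return (subV-subV e v)
subC-subC e (‵op o v c)        = cong₂ (‵op o) (subV-subV e v) (subC-subC (exts-exts e) c)
subC-subC e (‵do c₁ c₂)        = cong₂ ‵do (subC-subC e c₁) (subC-subC (exts-exts e) c₂)
subC-subC e (‵with v handle c) = cong₂ ‵with_handle_ (subV-subV e v) (subC-subC e c)
subH-subH e []          = refl
subH-subH e (o ↦ c ∷ h) = cong₂ (o ↦_∷_) (subC-subC (exts-exts (exts-exts e)) c) (subH-subH e h)

exts-id : σ ≗ ‵var → exts σ ≗ ‵var
exts-id e zero    = refl
exts-id e (suc n) = cong (renV suc) (e n)

subV-id : σ ≗ ‵var → subV σ ≗ id
subC-id : σ ≗ ‵var → subC σ ≗ id
subH-id : σ ≗ ‵var → subH σ ≗ id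
subV-id e (‵var n)        = e n
subV-id e ‵unit           = refl
subV-id e ‵true           = refl
subV-id e ‵false          = refl
subV-id e (‵fun c)        = cong ‵fun (subC-id (exts-id e) c)
subV-id e (‵handler cr h) = cong₂ ‵handler (subC-id (exts-id e) cr) (subH-id e h)
subC-id e (‵if v c₁ c₂)      = cong₃ ‵if (subV-id e v) (subC-id e c₁) (subC-id e c₂)
subC-id e (‵app v₁ v₂)       = cong₂ ‵app (subV-id e v₁) (subV-id e v₂)
subC-id e (‵return v)        = cong ‵return (subV-id e v)
subC-id e (‵op o v c)        = cong₂ (‵op o) (subV-id e v) (subC-id (exts-id e) c)
subC-id e (‵do c₁ c₂)        = cong₂ ‵do (subC-id e c₁) (subC-id (exts-id e) c₂)
subC-id e (‵with v handle c) = cong₂ ‵with_handle_ (subV-id e v) (subC-id e c)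
subH-id e []          = refl
subH-id e (o ↦ c ∷ h) = cong₂ (o ↦_∷_) (subC-id (exts-id (exts-id e)) c) (subH-id e h)

subV-renV-cancel : σ ∘ ρ ≗ ‵var → subV σ ∘ renV ρ ≗ id
subV-renV-cancel e v = trans (subV-renV e v) (subV-id (λ _ → refl) v)

subC-renC-cancel : σ ∘ ρ ≗ ‵var → subC σ ∘ renC ρ ≗ id
subC-renC-cancel e c = trans (subC-renC e c) (subC-id (λ _ → refl) c)

subC-cong : σ ≗ σ' → subC σ ≗ subC σ'
subC-cong {σ = σ} e c = trans (cong (subC σ) (sym (subC-id (λ _ → refl) c))) (subC-subC e c)

_•_ : Val → (ℕ → Val) → ℕ → Val
(w • σ) zero    = w
(w • σ) (suc n) = σ n

[]-as-subC : ∀ c w → c [ w ] ≡ subC (w • ‵var) c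
[]-as-subC c w = subC-cong (λ { zero → refl ; (suc n) → refl }) c

[/x,/k]-as-subC : ∀ c w k → c [ w /x, k /k] ≡ subC (k • (w • ‵var)) c
[/x,/k]-as-subC c w k = subC-cong (λ { zero → refl ; (suc zero) → refl ; (suc (suc n)) → refl }) c

exts-[] : ∀ σ c w → subC (exts σ) c [ w ] ≡ subC (w • σ) c
exts-[] σ c w = trans ([]-as-subC (subC (exts σ) c) w) (subC-subC pointwise c)
  where
  pointwise : subV (w • ‵var) ∘ exts σ ≗ w • σ
  pointwise zero    = refl
  pointwise (suc n) = subV-renV-cancel (λ _ → refl) (σ n)

exts²-[/x,/k] : ∀ σ c w k → subC (exts (exts σ)) c [ w /x, k /k] ≡ subC (k • (w • σ)) c
exts²-[/x,/k] σ c w k = trans ([/x,/k]-as-subC (subC (exts (exts σ)) c) w k) (subC-subC pointwise c)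
  where
  pointwise : subV (k • (w • ‵var)) ∘ exts (exts σ) ≗ k • (w • σ)
  pointwise zero          = refl
  pointwise (suc zero)    = refl
  pointwise (suc (suc n)) =
    trans (subV-renV {τ = w • ‵var} (λ _ → refl) (renV suc (σ n))) (subV-renV-cancel (λ _ → refl) (σ n))

with-weakened-[] : ∀ H c t → (‵with renV suc H handle c) [ t ] ≡ ‵with H handle (c [ t ])
with-weakened-[] H c t = trans ([]-as-subC (‵with renV suc H handle c) t)
  (cong₂ ‵with_handle_ (subV-renV-cancel (λ _ → refl) H) (sym ([]-as-subC c t)))

do-weakened-[] : ∀ c₁ c₂ t → (‵do c₁ (renC (ext suc) c₂)) [ t ] ≡ ‵do (c₁ [ t ]) c₂
do-weakened-[] c₁ c₂ t = trans ([]-as-subC (‵do c₁ (renC (ext suc) c₂)) t)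
  (cong₂ ‵do (sym ([]-as-subC c₁ t)) (subC-renC-cancel (λ { zero → refl ; (suc n) → refl }) c₂))

∈ᶜ-subH : ∀ {o c h} → o ↦ c ∈ᶜ h → o ↦ subC (exts (exts σ)) c ∈ᶜ subH σ h
∈ᶜ-subH here      = here
∈ᶜ-subH (there m) = there (∈ᶜ-subH m)

‵bool : Bool → Val
‵bool true  = ‵true
‵bool false = ‵false

ValRel  : (A : VTy) → ⟦ A ⟧V → Val → Set
CompRel : (C : CTy) → ⟦ C ⟧C → Comp → Set
FreeRel : (A : VTy) (Σ : List Decl) → Free (Sh Σ) (Ps Σ) ⟦ A ⟧V → Comp → Set
-- OpRel Σ s K o w c' : the call o(w; y.c') has shape s, and K relates each
-- position p to c' with every value related to p substituted for y.
OpRel   : (Σ : List Decl) (s : Sh Σ) → (Ps Σ s → Comp → Set) → Op → Val → Comp → Set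

ValRel unit    _ _ = ⊤
ValRel bool    b v = v ≡ ‵bool b
ValRel (A ⟶ C) f v = ∀ a w → ValRel A a w → CompRel C (f a) (‵app v w)
ValRel (C ⇒ D) f v = ∀ m c → CompRel C m c → CompRel D (f m) (‵with v handle c)
CompRel (comp A Σ _ _) = FreeRel A Σ
FreeRel A Σ (inRet a)  c = ∃ λ v → (c ↝* ‵return v) × ValRel A a v
FreeRel A Σ (inOp s κ) c = ∃ λ o → ∃ λ w → ∃ λ c' →
  (c ↝* ‵op o w c') × OpRel Σ s (λ p → FreeRel A Σ (κ p)) o w c'
OpRel (decl o' A B ∷ Σ) (inj₁ a) K o w c' =
  (o ≡ o') × ValRel A a w × (∀ b t → ValRel B b t → K b (c' [ t ]))
OpRel (decl _ _ _ ∷ Σ) (inj₂ s) K o w c' = OpRel Σ s K o w c'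

FreeRel-expand : ∀ A Σ m {c c'} → c ↝* c' → FreeRel A Σ m c' → FreeRel A Σ m c
FreeRel-expand A Σ (inRet a)  r (v , r' , x)          = v , r ◅◅ r' , x
FreeRel-expand A Σ (inOp s κ) r (o , w , c' , r' , x) = o , w , c' , r ◅◅ r' , x

CompRel-expand : ∀ C m {c c'} → c ↝* c' → CompRel C m c' → CompRel C m c
CompRel-expand (comp A Σ _ _) = FreeRel-expand A Σ

CompRel-if : ∀ C b {v c₁ c₂ m₁ m₂} → v ≡ ‵bool b → CompRel C m₁ c₁ → CompRel C m₂ c₂ →
             CompRel C (if b then m₁ else m₂) (‵if v c₁ c₂)
CompRel-if C true  refl r₁ r₂ = CompRel-expand C _ (ifTrue ◅ ε) r₁
CompRel-if C false refl r₁ r₂ = CompRel-expand C _ (ifFalse ◅ ε) r₂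

OpRel-shape : ∀ {A B o Σ} (m : decl o A B ∈ Σ) (a : ⟦ A ⟧V) {K w c'} → ValRel A a w →
              (∀ p t → ValRel B (pos m a p) t → K p (c' [ t ])) → OpRel Σ (shape m a) K o w c'
OpRel-shape (here refl) a rw rc = refl , rw , rc
OpRel-shape {Σ = decl _ _ _ ∷ _} (there m) a rw rc = OpRel-shape m a rw rc

OpRel-map : ∀ Σ s {K K' o w c' c''} → OpRel Σ s K o w c' →
            (∀ p t → K p (c' [ t ]) → K' p (c'' [ t ])) → OpRel Σ s K' o w c''
OpRel-map (decl _ _ _ ∷ Σ) (inj₁ a) (e , rw , rc) f = e , rw , λ b t r → f b t (rc b t r)
OpRel-map (decl _ _ _ ∷ Σ) (inj₂ s) x f = OpRel-map Σ s x f

FreeRel-do : ∀ {A B Σ} {f : ⟦ A ⟧V → Free (Sh Σ) (Ps Σ) ⟦ B ⟧V} m {c₁ c₂} → FreeRel A Σ m c₁ →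
             (∀ a w → ValRel A a w → FreeRel B Σ (f a) (c₂ [ w ])) →
             FreeRel B Σ (lift f inOp m) (‵do c₁ c₂)
FreeRel-do {B = B} {Σ} (inRet a) {c₂ = c₂} (v , r , x) rf =
  FreeRel-expand B Σ _ (gmap (λ c → ‵do c c₂) doCong r ◅◅ (doReturn ◅ ε)) (rf a v x)
FreeRel-do {B = B} {Σ} {f} (inOp s κ) {c₂ = c₂} (o , w , c' , r , x) rf =
  o , w , ‵do c' (renC (ext suc) c₂) , gmap (λ c → ‵do c c₂) doCong r ◅◅ (doOp ◅ ε) ,
  OpRel-map Σ s x (λ p t rκ → subst (FreeRel B Σ (lift f inOp (κ p))) (sym (do-weakened-[] c' c₂ t))
                                    (FreeRel-do (κ p) rκ rf))

EnvRel : (Γ : Ctx) → Env Γ → (ℕ → Val) → Set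
EnvRel Γ η σ = ∀ {n A} (x : Γ ∋ n ⦂ A) → ValRel A (lookupEnv x η) (σ n)

EnvRel-[] : EnvRel [] tt ‵var
EnvRel-[] ()

EnvRel-∷ : ∀ {Γ η A a w} → EnvRel Γ η σ → ValRel A a w → EnvRel (A ∷ Γ) (a , η) (w • σ)
EnvRel-∷ g r here      = r
EnvRel-∷ g r (there x) = g x

module _ {L : Logic} where
  fundamentalᵛ : ∀ {Γ v A} (d : L ∣ Γ ⊢v v ⦂ A) {η σ} → EnvRel Γ η σ →
                 ValRel A (⟦ d ⟧v η) (subV σ v)
  fundamentalᶜ : ∀ {Γ c C} (d : L ∣ Γ ⊢c c ⦂ C) {η σ} → EnvRel Γ η σ →
                 CompRel C (⟦ d ⟧c η) (subC σ c)
  fundamental-handle :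
    ∀ {Γ A Σ D cr h} (dr : L ∣ (A ∷ Γ) ⊢c cr ⦂ D) (cls : ClausesTy L Γ h D Σ) {η σ} →
    EnvRel Γ η σ → ∀ m c → FreeRel A Σ m c →
    CompRel D (lift (λ a → ⟦ dr ⟧c (a , η)) (interp cls η) m) (‵with subV σ (‵handler cr h) handle c)
  fundamental-clause :
    ∀ {Γ h D Σ} (cls : ClausesTy L Γ h D Σ) {η σ} → EnvRel Γ η σ →
    ∀ cr (s : Sh Σ) (K : Ps Σ s → Comp → Set) (κ : Ps Σ s → ⟦ D ⟧C) {o w c} →
    (∀ p t → K p t → CompRel D (κ p) (‵with ‵handler cr (subH σ h) handle t)) →
    OpRel Σ s K o w c →
    CompRel D (interp cls η s κ) (‵with ‵handler cr (subH σ h) handle ‵op o w c)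

  fundamentalᵛ (varT x)  g = g x
  fundamentalᵛ unitT     g = tt
  fundamentalᵛ trueT     g = refl
  fundamentalᵛ falseT    g = refl
  fundamentalᵛ (funT {C = C} {c = c} d) {σ = σ} g a w r =
    CompRel-expand C _ (β ◅ ε) (subst (CompRel C _) (sym (exts-[] σ c w)) (fundamentalᶜ d (EnvRel-∷ g r)))
  fundamentalᵛ (handlerT dr cls _ _ _ _) g = fundamental-handle dr cls g

  fundamentalᶜ (ifT {C = C} dv d₁ d₂) {η} g =
    CompRel-if C (⟦ dv ⟧v η) (fundamentalᵛ dv g) (fundamentalᶜ d₁ g) (fundamentalᶜ d₂ g)
  fundamentalᶜ (appT d₁ d₂) g = fundamentalᵛ d₁ g _ _ (fundamentalᵛ d₂ g)
  fundamentalᶜ (returnT dv) g = _ , ε , fundamentalᵛ dv g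
  fundamentalᶜ (opT {o = o} {v = v} {c = c} {A = A} {Σ = Σ} m dv dc) {η} {σ} g =
    o , subV σ v , subC (exts σ) c , ε ,
    OpRel-shape m (⟦ dv ⟧v η) (fundamentalᵛ dv g)
      (λ p t r → subst (FreeRel A Σ _) (sym (exts-[] σ c t)) (fundamentalᶜ dc (EnvRel-∷ g r)))
  fundamentalᶜ (doT {c₂ = c₂} {B = B} {Σ = Σ} d₁ d₂) {η} {σ} g =
    FreeRel-do (⟦ d₁ ⟧c η) (fundamentalᶜ d₁ g)
      (λ a w r → subst (FreeRel B Σ _) (sym (exts-[] σ c₂ w)) (fundamentalᶜ d₂ (EnvRel-∷ g r)))
  fundamentalᶜ (withT dv dc) g = fundamentalᵛ dv g _ _ (fundamentalᶜ dc g)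

  fundamental-handle {D = D} {cr = cr} dr cls {σ = σ} g (inRet a) c (v , r , x) =
    CompRel-expand D _ (gmap (‵with_handle_ (subV σ (‵handler cr _))) withCong r ◅◅ (withReturn ◅ ε))
      (subst (CompRel D _) (sym (exts-[] σ cr v)) (fundamentalᶜ dr (EnvRel-∷ g x)))
  fundamental-handle {A = A} {Σ = Σ} {D = D} {cr = cr} {h = h} dr cls {η} {σ} g (inOp s κ) c
                     (o , w , c' , r , x) =
    CompRel-expand D _ (gmap (‵with_handle_ (subV σ (‵handler cr h))) withCong r)
      (fundamental-clause cls g (subC (exts σ) cr) s (λ p → FreeRel A Σ (κ p))
        (λ p → lift (λ a → ⟦ dr ⟧c (a , η)) (interp cls η) (κ p))
        (λ p → fundamental-handle dr cls g (κ p)) x)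

  fundamental-clause {h = h} {D = D} ((mem , dop) ∷ cls) {σ = σ} g cr (inj₁ a) K κ {w = w} {c}
                     rκ (refl , rw , rc) =
    CompRel-expand D _ (withOp (∈ᶜ-subH mem) ◅ ε)
      (subst (CompRel D _) (sym (exts²-[/x,/k] σ _ w k)) (fundamentalᶜ dop (EnvRel-∷ (EnvRel-∷ g rw) rk)))
    where
    H = ‵handler cr (subH σ h)
    k = ‵fun (‵with renV suc H handle c)
    rk : ∀ b t → ValRel _ b t → CompRel D (κ b) (‵app k t)
    rk b t r = CompRel-expand D _ (β ◅ ε)
                 (subst (CompRel D (κ b)) (sym (with-weakened-[] H c t)) (rκ b (c [ t ]) (rc b t r)))
  fundamental-clause (_ ∷ cls) g cr (inj₂ s) K κ rκ r = fundamental-clause cls g cr s K κ rκ r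

  closed-bool-value : ∀ {v} (dv : L ∣ [] ⊢v v ⦂ bool) → v ≡ ‵bool (⟦ dv ⟧v tt)
  closed-bool-value dv = trans (sym (subV-id (λ _ → refl) _)) (fundamentalᵛ dv EnvRel-[])

  closed-bool-return : ∀ {c b} (dc : L ∣ [] ⊢c c ⦂ bool!∅/∅) → ⟦ dc ⟧c tt ≡ inRet b →
                       c ↝* ‵return (‵bool b)
  closed-bool-return {c} dc ⟦c⟧≡b
    with subst (λ m → CompRel bool!∅/∅ m (subC ‵var c)) ⟦c⟧≡b (fundamentalᶜ dc EnvRel-[])
  ... | _ , c↝*b , refl = subst (_↝* _) (subC-id (λ _ → refl) c) c↝*b

∼⇒≡ : ∀ {x y} → x ∼ y → x ≡ y
∼⇒≡ (∼ret e)     = cong inRet e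
∼⇒≡ (∼sym p)     = sym (∼⇒≡ p)
∼⇒≡ (∼trans p q) = trans (∼⇒≡ p) (∼⇒≡ q)
∼⇒≡ (∼op () _)

lemma5 : (L : Logic) (c : Comp) (v : Val)
         (dc : L ∣ [] ⊢c c ⦂ bool!∅/∅) (dv : L ∣ [] ⊢v v ⦂ bool) →
         ⟦ dc ⟧c tt ∼ inRet (⟦ dv ⟧v tt) →
         c ↝* ‵return v
lemma5 L c v dc dv c∼v =
  subst (λ w → c ↝* ‵return w) (sym (closed-bool-value dv)) (closed-bool-return dc (∼⇒≡ c∼v))
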